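{- Let $Z$ be a uniform $d$-NBP and let $P_1,P_2$ be two directed paths of $Z$ having the same initial vertex and the same final vertex. Then a variable occurs as an edge label on $P_1$ if and only if it occurs as an edge label on $P_2$.
   Context: An NBP $Z$ is a directed acyclic multigraph with one source and one sink, some edges labelled with literals of Boolean variables. It is a uniform $d$-NBP if every variable of $Z$ occurs exactly $d$ times as an edge label on every source–sink path. -}

module Defs where

open import Data.Nat using (ℕ; zero; suc; _+_)
open import Data.Fin using (Fin)
open import Data.Bool using (Bool)
open import Data.Maybe using (Maybe; just; nothing)
open import Data.Product using (Σ; _×_; _,_; ∃; proj₁)
open import Relation.Binary.PropositionalEquality using (_≡_)
open import Relation.Nullary using (¬_; Dec; yes; no)
open import Data.Fin using (_≟_)

-- A literal over variables Fin n: a variable together with a polarity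
-- (true = positive literal x, false = negated literal ¬x).
Literal : ℕ → Set
Literal n = Fin n × Bool

record LabelledMultigraph (n : ℕ) : Set where
  field
    V E   : ℕ
    src   : Fin E → Fin V
    tgt   : Fin E → Fin V
    label : Fin E → Maybe (Literal n)

module _ {n : ℕ} (G : LabelledMultigraph n) where
  open LabelledMultigraph G

  data Path : Fin V → Fin V → Set where
    []  : ∀ {u} → Path u u
    _∷_ : ∀ {v} (e : Fin E) → Path (tgt e) v → Path (src e) v

  length : ∀ {u v} → Path u v → ℕ
  length []      = 0
  length (e ∷ p) = suc (length p)

  LabelledBy : Fin n → Fin E → Set
  LabelledBy x e = Σ Bool λ b → label e ≡ just (x , b)

  labelledBy? : (x : Fin n) (e : Fin E) → Dec (LabelledBy x e)
  labelledBy? x e with label e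
  ... | nothing = no λ { (_ , ()) }
  ... | just (y , b) with y ≟ x
  ...   | yes _≡_.refl = yes (b , _≡_.refl)
  ...   | no y≢x = no λ { (_ , _≡_.refl) → y≢x _≡_.refl }

  occurrences : Fin n → ∀ {u v} → Path u v → ℕ
  occurrences x [] = 0
  occurrences x (e ∷ p) with labelledBy? x e
  ... | yes _ = suc (occurrences x p)
  ... | no _  = occurrences x p

  data OccursOn (x : Fin n) : ∀ {u v} → Path u v → Set where
    here  : ∀ {v} {e} {p : Path (tgt e) v} → LabelledBy x e → OccursOn x (e ∷ p)
    there : ∀ {v} {e} {p : Path (tgt e) v} → OccursOn x p → OccursOn x (e ∷ p)

  VariableOf : Fin n → Set
  VariableOf x = ∃ λ e → LabelledBy x e

  InDegreeZero : Fin V → Set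
  InDegreeZero v = ∀ e → ¬ tgt e ≡ v

  OutDegreeZero : Fin V → Set
  OutDegreeZero v = ∀ e → ¬ src e ≡ v

  Acyclic : Set
  Acyclic = ∀ {v} (p : Path v v) → length p ≡ 0

record NBP (n : ℕ) : Set where
  field
    graph   : LabelledMultigraph n
  open LabelledMultigraph graph public
  field
    source  : Fin V
    sink    : Fin V
    acyclic : Acyclic graph
    source-isSource : InDegreeZero graph source
    source-unique   : ∀ v → InDegreeZero graph v → v ≡ source
    sink-isSink     : OutDegreeZero graph sink
    sink-unique     : ∀ v → OutDegreeZero graph v → v ≡ sink

IsUniform : ∀ {n} → ℕ → NBP n → Set
IsUniform d Z =
  ∀ (x : Fin _) → VariableOf (NBP.graph Z) x →
  (p : Path (NBP.graph Z) (NBP.source Z) (NBP.sink Z)) →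
  occurrences (NBP.graph Z) x p ≡ d

-- Extend any u–v path by one fixed source–u path and one fixed v–sink path.
-- Both extensions are source–sink paths, so by uniformity each variable x of Z
-- occurs d times on both; cancelling the common prefix and suffix shows that
-- P₁ and P₂ carry the same number of occurrences of x. The prefix and suffix
-- exist because in an acyclic graph a path has fewer than V edges, so walking
-- backwards (forwards) must get stuck at a vertex of in-degree (out-degree)
-- zero, which is the unique source (sink).
module Submission where

open import Defs
open import Data.Nat using (ℕ; zero; suc; _+_; _<_; s≤s; z≤n)
open import Data.Nat.Properties using (<-irrefl; ≮⇒≥; +-cancelˡ-≡; +-cancelʳ-≡)
import Data.Nat as ℕ
open import Data.Fin as Fin using (Fin; _≟_)
open import Data.Fin.Properties using (pigeonhole; any?)
open import Data.Product using (Σ; ∃; _×_; _,_)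
open import Data.Sum using (_⊎_; inj₁; inj₂)
open import Data.Empty using (⊥; ⊥-elim)
open import Relation.Nullary using (yes; no)
open import Relation.Binary.PropositionalEquality
  using (_≡_; refl; cong; subst; module ≡-Reasoning)

module _ {n : ℕ} {G : LabelledMultigraph n} where
  open LabelledMultigraph G

  _++_ : ∀ {a b c} → Path G a b → Path G b c → Path G a c
  []      ++ q = q
  (e ∷ p) ++ q = e ∷ (p ++ q)

  occurrences-++ : ∀ x {a b c} (p : Path G a b) (q : Path G b c) →
                   occurrences G x (p ++ q) ≡ occurrences G x p + occurrences G x q
  occurrences-++ x []      q = refl
  occurrences-++ x (e ∷ p) q with labelledBy? G x e
  ... | yes _ = cong suc (occurrences-++ x p q)
  ... | no  _ = occurrences-++ x p q

  OccursOn⇒occurrences>0 : ∀ {x a b} {p : Path G a b} → OccursOn G x p → 0 < occurrences G x p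
  OccursOn⇒occurrences>0 {x} {p = e ∷ p} o with labelledBy? G x e | o
  ... | yes _  | _       = s≤s z≤n
  ... | no ¬xe | here xe = ⊥-elim (¬xe xe)
  ... | no _   | there o = OccursOn⇒occurrences>0 o

  occurrences>0⇒OccursOn : ∀ {x a b} (p : Path G a b) → 0 < occurrences G x p → OccursOn G x p
  occurrences>0⇒OccursOn {x} (e ∷ p) pos with labelledBy? G x e
  ... | yes xe = here xe
  ... | no _   = there (occurrences>0⇒OccursOn p pos)

  OccursOn⇒VariableOf : ∀ {x a b} {p : Path G a b} → OccursOn G x p → VariableOf G x
  OccursOn⇒VariableOf (here {e = e} xe) = e , xe
  OccursOn⇒VariableOf (there o)         = OccursOn⇒VariableOf o

  vertexAt : ∀ {a b} (p : Path G a b) → Fin (suc (length G p)) → Fin V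
  vertexAt {a} []      Fin.zero    = a
  vertexAt     (e ∷ p) Fin.zero    = src e
  vertexAt     (e ∷ p) (Fin.suc i) = vertexAt p i

  take : ∀ {a b} (p : Path G a b) (i : Fin (suc (length G p))) → Path G a (vertexAt p i)
  take []      Fin.zero    = []
  take (e ∷ p) Fin.zero    = []
  take (e ∷ p) (Fin.suc i) = e ∷ take p i

module _ {n : ℕ} (G : LabelledMultigraph n) (acyclic : Acyclic G) where
  open LabelledMultigraph G

  private
    acyclic-closed : ∀ {a b} → a ≡ b → (p : Path G a b) → length G p ≡ 0
    acyclic-closed refl p = acyclic p

  acyclic⇒vertexAt-injective : ∀ {a b} (p : Path G a b) (i j : Fin (suc (length G p))) →
                               i Fin.< j → vertexAt p i ≡ vertexAt p j → ⊥
  acyclic⇒vertexAt-injective (e ∷ p) Fin.zero (Fin.suc j) _ eq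
    with acyclic-closed eq (e ∷ take p j)
  ... | ()
  acyclic⇒vertexAt-injective (e ∷ p) (Fin.suc i) (Fin.suc j) (s≤s i<j) eq =
    acyclic⇒vertexAt-injective p i j i<j eq

  acyclic⇒length<V : ∀ {a b} (p : Path G a b) → length G p < V
  acyclic⇒length<V p with length G p ℕ.<? V
  ... | yes p<V = p<V
  ... | no  p≮V with pigeonhole (s≤s (≮⇒≥ p≮V)) (vertexAt p)
  ...   | i , j , i<j , eq = ⊥-elim (acyclic⇒vertexAt-injective p i j i<j eq)

  private
    walkBackward : ∀ k u → (∃ λ w → InDegreeZero G w × Path G w u)
                         ⊎ (∃ λ w → Σ (Path G w u) λ p → length G p ≡ k)
    walkBackward zero    u = inj₂ (u , [] , refl)
    walkBackward (suc k) u with walkBackward k u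
    ... | inj₁ stuck = inj₁ stuck
    ... | inj₂ (w , p , refl) with any? (λ e → tgt e ≟ w)
    ...   | no ∄e          = inj₁ (w , (λ e te → ∄e (e , te)) , p)
    ...   | yes (e , refl) = inj₂ (src e , e ∷ p , refl)

    walkForward : ∀ k u → (∃ λ w → OutDegreeZero G w × Path G u w)
                        ⊎ (∃ λ w → Σ (Path G u w) λ p → length G p ≡ k)
    walkForward zero    u = inj₂ (u , [] , refl)
    walkForward (suc k) u with any? (λ e → src e ≟ u)
    ... | no ∄e          = inj₁ (u , (λ e se → ∄e (e , se)) , [])
    ... | yes (e , refl) with walkForward k (tgt e)
    ...   | inj₁ (w , w-out , p) = inj₁ (w , w-out , e ∷ p)
    ...   | inj₂ (w , p , refl)  = inj₂ (w , e ∷ p , refl)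

  acyclic⇒reachedFromInDegreeZero : ∀ u → ∃ λ w → InDegreeZero G w × Path G w u
  acyclic⇒reachedFromInDegreeZero u with walkBackward V u
  ... | inj₁ stuck         = stuck
  ... | inj₂ (_ , p , len) = ⊥-elim (<-irrefl len (acyclic⇒length<V p))

  acyclic⇒reachesOutDegreeZero : ∀ u → ∃ λ w → OutDegreeZero G w × Path G u w
  acyclic⇒reachesOutDegreeZero u with walkForward V u
  ... | inj₁ stuck         = stuck
  ... | inj₂ (_ , p , len) = ⊥-elim (<-irrefl len (acyclic⇒length<V p))

module _ {n : ℕ} (Z : NBP n) where
  open NBP Z

  pathFromSource : ∀ u → Path graph source u
  pathFromSource u with acyclic⇒reachedFromInDegreeZero graph acyclic u
  ... | w , w-in , p = subst (λ w → Path graph w u) (source-unique w w-in) p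

  pathToSink : ∀ u → Path graph u sink
  pathToSink u with acyclic⇒reachesOutDegreeZero graph acyclic u
  ... | w , w-out , p = subst (Path graph u) (sink-unique w w-out) p

  uniform⇒occurrences≡ : ∀ {d} → IsUniform d Z → ∀ {u v} (P₁ P₂ : Path graph u v) x →
                         VariableOf graph x → occurrences graph x P₁ ≡ occurrences graph x P₂
  uniform⇒occurrences≡ {d} uniform {u} {v} P₁ P₂ x x∈Z =
    +-cancelʳ-≡ (# S) (# P₁) (# P₂) (+-cancelˡ-≡ (# R) (# P₁ + # S) (# P₂ + # S) (begin
      # R + (# P₁ + # S)  ≡⟨ occurrences-through P₁ ⟨
      # (R ++ (P₁ ++ S))  ≡⟨ uniform x x∈Z (R ++ (P₁ ++ S)) ⟩
      d                   ≡⟨ uniform x x∈Z (R ++ (P₂ ++ S)) ⟨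
      # (R ++ (P₂ ++ S))  ≡⟨ occurrences-through P₂ ⟩
      # R + (# P₂ + # S)  ∎))
    where
    open ≡-Reasoning
    R = pathFromSource u
    S = pathToSink v

    # : ∀ {a b} → Path graph a b → ℕ
    # = occurrences graph x

    occurrences-through : (P : Path graph u v) → # (R ++ (P ++ S)) ≡ # R + (# P + # S)
    occurrences-through P = begin
      # (R ++ (P ++ S))     ≡⟨ occurrences-++ x R (P ++ S) ⟩
      # R + # (P ++ S)      ≡⟨ cong (# R +_) (occurrences-++ x P S) ⟩
      # R + (# P + # S)     ∎

lemma2 : ∀ {n : ℕ} (d : ℕ) (Z : NBP n) → IsUniform d Z →
    ∀ {u v : Fin (NBP.V Z)} (P₁ P₂ : Path (NBP.graph Z) u v) (x : Fin n) →
    (OccursOn (NBP.graph Z) x P₁ → OccursOn (NBP.graph Z) x P₂) ×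
    (OccursOn (NBP.graph Z) x P₂ → OccursOn (NBP.graph Z) x P₁)
lemma2 d Z uniform {u} {v} P₁ P₂ x = transfer P₁ P₂ , transfer P₂ P₁
  where
  transfer : (P Q : Path (NBP.graph Z) u v) → OccursOn (NBP.graph Z) x P → OccursOn (NBP.graph Z) x Q
  transfer P Q x∈P = occurrences>0⇒OccursOn Q
    (subst (0 <_) (uniform⇒occurrences≡ Z uniform P Q x (OccursOn⇒VariableOf x∈P))
                  (OccursOn⇒occurrences>0 x∈P))
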